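{- (i) For every $n\geq 2$, $\chi_d^t(P_n\circ K_1)=n+1$. (ii) For every $n\geq 3$, $\chi_d^t(C_n\circ K_1)=n+1$.
   Context: $P_n$ is the path on $n$ vertices, $C_n$ the cycle on $n$ vertices, $K_1$ the single-vertex graph. For graphs $G$ and $H$, the corona $G\circ H$ is obtained from the disjoint union of $G$ and $|V(G)|$ copies of $H$ by joining the $i$-th vertex of $G$ to all vertices of the $i$-th copy of $H$; thus $G\circ K_1$ attaches one pendant vertex to each vertex of $G$. For a graph with no isolated vertex, a total dominator coloring (TD-coloring) is a proper vertex coloring in which every vertex is adjacent to every vertex of some color class (a class other than its own); $\chi_d^t$ denotes the minimum number of colors in such a coloring. -}

module Defs where

open import Level using (0ℓ)
open import Data.Nat using (ℕ; zero; suc; _+_; _<_)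
open import Data.Fin using (Fin; toℕ)
open import Data.Sum using (_⊎_; inj₁; inj₂)
open import Data.Product using (Σ; ∃; _×_; _,_)
open import Data.Empty using (⊥)
open import Relation.Nullary using (¬_)
open import Relation.Binary.PropositionalEquality using (_≡_)

PathAdj : {n : ℕ} → Fin n → Fin n → Set
PathAdj i j = (suc (toℕ i) ≡ toℕ j) ⊎ (suc (toℕ j) ≡ toℕ i)

CycleAdj : {n : ℕ} → Fin n → Fin n → Set
CycleAdj {n} i j = PathAdj i j ⊎ ((toℕ i ≡ 0 × suc (toℕ j) ≡ n) ⊎ (toℕ j ≡ 0 × suc (toℕ i) ≡ n))

-- Corona G ∘ K₁ for G on Fin n: vertices inj₁ i (original) and inj₂ i (pendant attached to i).
CoronaK1Adj : {n : ℕ} → (Fin n → Fin n → Set) → (Fin n ⊎ Fin n) → (Fin n ⊎ Fin n) → Set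
CoronaK1Adj A (inj₁ i) (inj₁ j) = A i j
CoronaK1Adj A (inj₁ i) (inj₂ j) = i ≡ j
CoronaK1Adj A (inj₂ i) (inj₁ j) = i ≡ j
CoronaK1Adj A (inj₂ i) (inj₂ j) = ⊥

record IsTDColoring {V : Set} (Adj : V → V → Set) (k : ℕ) (c : V → Fin k) : Set where
  field
    proper    : ∀ u v → Adj u v → ¬ (c u ≡ c v)
    dominates : ∀ v → Σ (Fin k) λ j → (Σ V λ w → c w ≡ j) × (∀ w → c w ≡ j → Adj v w)

TDChromaticNumber : {V : Set} → (V → V → Set) → ℕ → Set
TDChromaticNumber {V} Adj k =
  (Σ (V → Fin k) λ c → IsTDColoring Adj k c) ×
  (∀ m → m < k → ¬ (Σ (V → Fin m) λ c → IsTDColoring Adj m c))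

module Submission where

open import Defs
open import Data.Nat using (ℕ; suc; _≤_; _<_; z≤n; s≤s)
open import Data.Nat.Properties using (1+n≢n; <⇒≱)
open import Data.Fin using (Fin; zero; suc; inject₁; fromℕ)
open import Data.Fin.Properties using (injective⇒≤; inject₁-injective; fromℕ≢inject₁; toℕ-inject₁)
open import Data.Vec.Functional using (_∷_)
open import Data.Product using (Σ; _×_; _,_)
open import Data.Sum using (_⊎_; inj₁; inj₂; [_,_])
open import Data.Empty using (⊥; ⊥-elim)
open import Function using (_∘_; const)
open import Function.Definitions using (Injective)
open import Relation.Nullary using (¬_)
open import Relation.Binary.PropositionalEquality using (_≡_; refl; sym; trans; cong; subst)

-- A pendant vertex has a single neighbour, so the colour class it dominates is the singleton
-- of its attachment vertex. Hence in G ∘ K₁ the n vertices of G occupy n singleton classes, and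
-- a pendant needs yet another colour: at least n + 1 colours. Conversely, n + 1 colours suffice
-- whenever G is loopless without isolated vertices: give the vertices of G distinct colours and
-- all pendants one extra colour.

pendant-neighbour : ∀ {n} (A : Fin n → Fin n → Set) {i} w → CoronaK1Adj A (inj₂ i) w → w ≡ inj₁ i
pendant-neighbour A (inj₁ j) i≡j = cong inj₁ (sym i≡j)

module CoronaLowerBound {n m : ℕ} (A : Fin n → Fin n → Set)
  {c : Fin n ⊎ Fin n → Fin m} (td : IsTDColoring (CoronaK1Adj A) m c) where
  open IsTDColoring td

  colourClass-singleton : ∀ i w → c w ≡ c (inj₁ i) → w ≡ inj₁ i
  colourClass-singleton i w cw≡ci with dominates (inj₂ i)
  ... | j , (u , cu≡j) , adj = pendant-neighbour A w (adj w (trans cw≡ci ci≡j))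
    where
    ci≡j : c (inj₁ i) ≡ j
    ci≡j = subst (λ v → c v ≡ j) (pendant-neighbour A u (adj u cu≡j)) cu≡j

  pendant-and-base-colours : Fin n → Fin (suc n) → Fin m
  pendant-and-base-colours p = c (inj₂ p) ∷ (c ∘ inj₁)

  pendant-and-base-colours-injective : ∀ p → Injective _≡_ _≡_ (pendant-and-base-colours p)
  pendant-and-base-colours-injective p {zero}  {zero}  _ = refl
  pendant-and-base-colours-injective p {zero}  {suc j} e with colourClass-singleton j (inj₂ p) e
  ... | ()
  pendant-and-base-colours-injective p {suc i} {zero}  e with colourClass-singleton i (inj₂ p) (sym e)
  ... | ()
  pendant-and-base-colours-injective p {suc i} {suc j} e with colourClass-singleton j (inj₁ i) e
  ... | refl = refl

  colours-≥ : Fin n → suc n ≤ m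
  colours-≥ p = injective⇒≤ (pendant-and-base-colours-injective p)

corona-no-TDColoring : ∀ {n} (A : Fin n → Fin n → Set) → Fin n → ∀ m → m < suc n →
  ¬ (Σ (Fin n ⊎ Fin n → Fin m) λ c → IsTDColoring (CoronaK1Adj A) m c)
corona-no-TDColoring A p m m<1+n (c , td) = <⇒≱ m<1+n (CoronaLowerBound.colours-≥ A td p)

module CoronaColouring {n : ℕ} (A : Fin n → Fin n → Set)
  (irreflexive : ∀ i → ¬ A i i) (neighbour : ∀ i → Σ (Fin n) (A i)) where

  colouring : Fin n ⊎ Fin n → Fin (suc n)
  colouring = [ inject₁ , const (fromℕ n) ]

  base-colour-injective : ∀ w {j} → colouring w ≡ inject₁ j → w ≡ inj₁ j
  base-colour-injective (inj₁ i) e = cong inj₁ (inject₁-injective e)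
  base-colour-injective (inj₂ i) e = ⊥-elim (fromℕ≢inject₁ e)

  proper : ∀ u v → CoronaK1Adj A u v → ¬ (colouring u ≡ colouring v)
  proper (inj₁ i) v a e with base-colour-injective v (sym e)
  ... | refl = irreflexive i a
  proper (inj₂ i) (inj₁ j) a e = fromℕ≢inject₁ e

  base-class-dominated : ∀ v {j} → CoronaK1Adj A v (inj₁ j) →
    ∀ w → colouring w ≡ inject₁ j → CoronaK1Adj A v w
  base-class-dominated v a w e = subst (CoronaK1Adj A v) (sym (base-colour-injective w e)) a

  dominates : ∀ v → Σ (Fin (suc n)) λ k →
    (Σ (Fin n ⊎ Fin n) λ w → colouring w ≡ k) × (∀ w → colouring w ≡ k → CoronaK1Adj A v w)
  dominates (inj₁ i) with neighbour i
  ... | j , aij = inject₁ j , (inj₁ j , refl) , base-class-dominated (inj₁ i) aij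
  dominates (inj₂ i) = inject₁ i , (inj₁ i , refl) , base-class-dominated (inj₂ i) refl

  isTDColoring : IsTDColoring (CoronaK1Adj A) (suc n) colouring
  isTDColoring = record { proper = proper ; dominates = dominates }

corona-TDChromaticNumber : ∀ {n} (A : Fin n → Fin n → Set) → Fin n →
  (∀ i → ¬ A i i) → (∀ i → Σ (Fin n) (A i)) → TDChromaticNumber (CoronaK1Adj A) (suc n)
corona-TDChromaticNumber A p irreflexive neighbour =
  (colouring , isTDColoring) , corona-no-TDColoring A p
  where open CoronaColouring A irreflexive neighbour

path-irreflexive : ∀ {n} (i : Fin n) → ¬ PathAdj i i
path-irreflexive i (inj₁ e) = 1+n≢n e
path-irreflexive i (inj₂ e) = 1+n≢n e

path-neighbour : ∀ {n} (i : Fin (suc (suc n))) → Σ (Fin (suc (suc n))) (PathAdj i)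
path-neighbour zero    = suc zero , inj₁ refl
path-neighbour (suc i) = inject₁ i , inj₂ (cong suc (toℕ-inject₁ i))

-- The wrap-around edge {0, n-1} is a loop only when n = 1.
wrap-around-absurd : ∀ {a n} → a ≡ 0 → suc a ≡ suc (suc n) → ⊥
wrap-around-absurd refl ()

cycle-irreflexive : ∀ {n} (i : Fin (suc (suc n))) → ¬ CycleAdj i i
cycle-irreflexive i (inj₁ e)                    = path-irreflexive i e
cycle-irreflexive i (inj₂ (inj₁ (i≡0 , 1+i≡n))) = wrap-around-absurd i≡0 1+i≡n
cycle-irreflexive i (inj₂ (inj₂ (i≡0 , 1+i≡n))) = wrap-around-absurd i≡0 1+i≡n

cycle-neighbour : ∀ {n} (i : Fin (suc (suc n))) → Σ (Fin (suc (suc n))) (CycleAdj i)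
cycle-neighbour i with path-neighbour i
... | j , aij = j , inj₁ aij

theorem2p4 : ((n : ℕ) → 2 ≤ n → TDChromaticNumber (CoronaK1Adj (PathAdj {n})) (suc n))
    × ((n : ℕ) → 3 ≤ n → TDChromaticNumber (CoronaK1Adj (CycleAdj {n})) (suc n))
theorem2p4 = path-corona , cycle-corona
  where
  path-corona : (n : ℕ) → 2 ≤ n → TDChromaticNumber (CoronaK1Adj (PathAdj {n})) (suc n)
  path-corona (suc (suc n)) (s≤s (s≤s z≤n)) =
    corona-TDChromaticNumber PathAdj zero path-irreflexive path-neighbour
  cycle-corona : (n : ℕ) → 3 ≤ n → TDChromaticNumber (CoronaK1Adj (CycleAdj {n})) (suc n)
  cycle-corona (suc (suc n)) (s≤s (s≤s _)) =
    corona-TDChromaticNumber CycleAdj zero cycle-irreflexive cycle-neighbour
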